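{- Let $U$ be a set of $n$ items arriving one per round in uniformly random order, $k\ge1$, $v\colon2^U\to\mathbb{R}_{\ge0}$ monotone submodular, and $\mathcal{A}$ an algorithm that for every $L\subseteq U$ returns a set $\mathcal{A}(L)\subseteq L$ with $|\mathcal{A}(L)|\le k$, depending only on $L$. For $\ell\in[n]$ let $U^{\le\ell}$ be the set of items arriving in rounds $1,\dots,\ell$ and $j_\ell$ the item arriving in round $\ell$. Define random sets $\mathrm{ALG}^{\ge\ell}_r\subseteq U$ for $\ell\in\{1,\dots,n+1\}$ and $r\in\{0,\dots,k\}$ by $\mathrm{ALG}^{\ge\ell}_0=\emptyset$ for all $\ell$, $\mathrm{ALG}^{\ge n+1}_r=\emptyset$ for all $r$, and for $\ell\in[n]$, $r>0$: $\mathrm{ALG}^{\ge\ell}_r=\{j_\ell\}\cup\mathrm{ALG}^{\ge\ell+1}_{r-1}$ if $j_\ell\in\mathcal{A}(U^{\le\ell})$ and $\mathrm{ALG}^{\ge\ell}_r=\mathrm{ALG}^{\ge\ell+1}_r$ otherwise. Then for all $\ell\in[n]$ and $r\in\{1,\dots,k\}$, \[\mathbb{E}[v(\mathrm{ALG}^{\ge\ell}_r)]\ge\frac1\ell\Big(\mathbb{E}[v(\mathcal{A}(U^{\le\ell}))]+(k-1)\mathbb{E}[v(\mathrm{ALG}^{\ge\ell+1}_{r-1})]+(\ell-k)\mathbb{E}[v(\mathrm{ALG}^{\ge\ell+1}_r)]\Big).\]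
   Context: $\mathrm{ALG}^{\ge\ell}_r$ is the set of the first $r$ items a hypothetical run of the online algorithm (accept the arriving item if it lies in $\mathcal{A}(U^{\le\ell})$ and capacity remains) would collect if started in round $\ell$ with remaining capacity $r$. Expectations are over the random arrival order.
   Formalization: The monotone submodular function v takes nonnegative rational values instead of values in $\mathbb{R}_{\ge0}$. -}

module Defs where

open import Data.Nat using (ℕ; zero; suc)
open import Data.Integer using (+_)
open import Data.Rational using (ℚ; 0ℚ; _+_; _*_; _/_; _≤_)
open import Data.Bool using (if_then_else_)
open import Data.List using (List; []; _∷_; map; concatMap; length; take; drop; foldr)
open import Data.Fin using (Fin)
open import Data.Vec using (lookup)
open import Data.Fin.Subset using (Subset; ⊥; ⁅_⁆; _∪_; _∩_; _⊆_; ∣_∣)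

insertions : {A : Set} → A → List A → List (List A)
insertions x [] = (x ∷ []) ∷ []
insertions x (y ∷ ys) = (x ∷ y ∷ ys) ∷ map (y ∷_) (insertions x ys)

perms : {A : Set} → List A → List (List A)
perms [] = [] ∷ []
perms (x ∷ xs) = concatMap (insertions x) (perms xs)

-- all arrival orders of the items Fin n: the list o, o[i] = item arriving in round i+1
orders : (n : ℕ) → List (List (Fin n))
orders n = perms (Data.List.allFin n)

sumℚ : List ℚ → ℚ
sumℚ = foldr _+_ 0ℚ

mean : List ℚ → ℚ
mean [] = 0ℚ
mean (x ∷ xs) = sumℚ (x ∷ xs) * (+ 1 / suc (length xs))

E : (n : ℕ) → (List (Fin n) → ℚ) → ℚ
E n f = mean (map f (orders n))

ℕtoℚ : ℕ → ℚ
ℕtoℚ m = + m / 1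

setOf : {n : ℕ} → List (Fin n) → Subset n
setOf = foldr (λ j S → ⁅ j ⁆ ∪ S) ⊥

prefixSet : {n : ℕ} → List (Fin n) → ℕ → Subset n
prefixSet o ℓ = setOf (take ℓ o)

-- hypothetical online run: S = items arrived so far (before the current round),
-- rest = items still to arrive, r = remaining capacity
run : {n : ℕ} → (Subset n → Subset n) → Subset n → List (Fin n) → ℕ → Subset n
run A S [] r = ⊥
run A S (j ∷ rest) zero = ⊥
run A S (j ∷ rest) (suc r) =
  if lookup (A (⁅ j ⁆ ∪ S)) j
  then ⁅ j ⁆ ∪ run A (⁅ j ⁆ ∪ S) rest r
  else run A (⁅ j ⁆ ∪ S) rest (suc r)

ALG≥ : {n : ℕ} → (Subset n → Subset n) → List (Fin n) → (ℓ r : ℕ) → Subset n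
ALG≥ A o ℓ r = run A (prefixSet o (ℓ Data.Nat.∸ 1)) (drop (ℓ Data.Nat.∸ 1) o) r

Monotone : {n : ℕ} → (Subset n → ℚ) → Set
Monotone v = ∀ S T → S ⊆ T → v S ≤ v T

Submodular : {n : ℕ} → (Subset n → ℚ) → Set
Submodular v = ∀ S T → v (S ∪ T) + v (S ∩ T) ≤ v S + v T

NonNegative : {n : ℕ} → (Subset n → ℚ) → Set
NonNegative v = ∀ S → 0ℚ ≤ v S

{-# OPTIONS --safe #-}
module Submission where

-- Fix the set L = U^{≤ℓ} of the first ℓ = m + 1 arrivals and the sequence r of later ones. Then
-- ALG^{≥ℓ}_{s+1} only depends on the item j arriving last in L: it is {j} ∪ B with B = ALG^{≥ℓ+1}_s
-- if j ∈ A(L), and B′ = ALG^{≥ℓ+1}_{s+1} otherwise. Rotating the first ℓ positions of the arrival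
-- order permutes the orders and makes each j ∈ L arrive last exactly once in ℓ rotations, so
-- ℓ · E[v(ALG^{≥ℓ}_{s+1})] is the expectation of Σ_{j ∈ L} of these values. For the c = |A(L)| ≤ k
-- items of A(L), submodularity gives Σ_{j ∈ A(L)} v({j} ∪ B) ≥ v(A(L) ∪ B) + (c - 1) v(B); the other
-- ℓ - c items contribute v(B′) ≥ v(B) each, and moving the weight k - c from v(B′) to v(B) only
-- decreases the sum.

open import Defs
open import Algebra.Bundles using (CommutativeMonoid)
open import Algebra.Properties.IdempotentCommutativeMonoid using (∙-distrʳ-∙)
open import Data.Bool using (Bool; true; false; if_then_else_; T)
open import Data.Bool.Properties using (if-float; T-≡)
open import Data.Empty using (⊥-elim)
open import Data.Fin using (Fin)
import Data.Fin as Fin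
open import Data.Fin.Subset using (Subset; ⁅_⁆; _∪_; _∩_; _⊆_; ∣_∣) renaming (_∈_ to _∈ₛ_; _∉_ to _∉ₛ_)
open import Data.Fin.Subset.Properties
  using ( x∈p∪q⁺; x∈p∪q⁻; x∈⁅x⁆; x∈⁅y⁆⇒x≡y; ∉⊥; ⊆-antisym; q⊆p∪q; p⊂q⇒∣p∣<∣q∣; p⊆q⇒∣p∣≤∣q∣
        ; ∪-distribʳ-∩; ∪-identityˡ; ∪-idempotentCommutativeMonoid)
open import Data.Integer as ℤ using (+_)
import Data.Integer.Properties as ℤ
import Data.List as List
open import Data.List using (List; []; _∷_; _++_; map; concatMap; length; take; drop; filter; filterᵇ; allFin)
open import Data.List.Properties
  using ( ∷-injectiveˡ; ∷-injectiveʳ; length-map; length-++; length-take; length-tabulate; ++-assoc; ++-identityʳ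
        ; take++drop≡id; map-cong; map-∘; map-id-local; filter-all; filter-accept; filter-reject)
open import Data.List.Membership.Propositional using (_∈_; _∉_; find; lose)
open import Data.List.Membership.Propositional.Properties
  using (∈-filter⁺; ∈-filter⁻; ∈-map⁻; ∈-map⁺; ∈-concatMap⁻; ∈-concatMap⁺; ∈-∃++)
open import Data.List.Membership.Propositional.Properties.WithK using (unique∧set⇒bag)
open import Data.List.Relation.Binary.BagAndSetEquality using (∼bag⇒↭)
open import Data.List.Relation.Binary.Permutation.Propositional
  using (_↭_; prep; swap; ↭-refl; ↭-sym; ↭-trans; ↭-reflexive; ↭⇒↭ₛ)
open import Data.List.Relation.Binary.Permutation.Propositional.Properties
  using (∈-resp-↭; ↭-empty-inv; ↭-length; drop-mid; ++-comm; ++⁺ʳ; map⁺)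
import Data.List.Relation.Binary.Permutation.Setoid.Properties as Permutationₛ
open import Data.List.Relation.Unary.All using ([]; _∷_)
import Data.List.Relation.Unary.All as All
open import Data.List.Relation.Unary.All.Properties using (¬Any⇒All¬)
open import Data.List.Relation.Unary.AllPairs using ([]; _∷_)
open import Data.List.Relation.Unary.Any using (here; there)
open import Data.List.Relation.Unary.Unique.Propositional using (Unique)
import Data.List.Relation.Unary.Unique.Propositional.Properties as Unique
open import Data.Nat using (ℕ; zero; suc; _<_)
import Data.Nat as ℕ
import Data.Nat.Properties as ℕ
open import Data.Nat.Coprimality using (1-coprimeTo)
import Data.Nat.Coprimality as Coprime
open import Data.Nat.GeneralisedArithmetic using (iterate; iterate-is-fold)
open import Data.Product using (_,_; _×_; proj₂)
open import Data.Rational using (ℚ; mkℚ; 0ℚ; 1ℚ; _+_; _*_; _-_; -_; _/_; _≤_; nonNegative)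
open import Data.Rational.Properties
  using ( normalize-coprime; normalize-nonNeg; nonNegative⁻¹; +-0-isCommutativeMonoid; +-0-commutativeMonoid
        ; +-assoc; +-identityˡ; +-identityʳ; +-inverseʳ; *-assoc; *-identityˡ; *-zeroˡ; *-zeroʳ; *-inverseˡ
        ; *-distribˡ-+; *-distribʳ-+; ≤-refl; ≤-trans; ≤-reflexive; +-mono-≤; +-monoˡ-≤; +-monoʳ-≤
        ; *-monoˡ-≤-nonNeg; *-monoʳ-≤-nonNeg; module ≤-Reasoning)
open import Data.Rational.Solver using (module +-*-Solver)
open +-*-Solver using (solve; _:+_; _:*_; _:-_; _:=_; con)
open import Algebra.Properties.CommutativeSemigroup
  (CommutativeMonoid.commutativeSemigroup +-0-commutativeMonoid) using (interchange)
open import Data.Sum using (inj₁; inj₂)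
import Data.Sum as Sum
open import Data.Vec using (lookup)
open import Data.Vec.Properties using ([]=⇒lookup; lookup⇒[]=)
open import Function using (_∘_; mk⇔; Equivalence)
open import Relation.Binary.Definitions using (DecidableEquality)
open import Relation.Binary.PropositionalEquality
  using (_≡_; _≢_; refl; sym; trans; cong; cong₂; subst; setoid; module ≡-Reasoning)
open import Relation.Nullary using (¬_; ¬?)
open import Relation.Nullary.Decidable using (T?)
-- Permutations of a list

module _ {A : Set} where

  ∈-insertions⁻ : ∀ {x : A} {o} xs → o ∈ insertions x xs → o ↭ x ∷ xs
  ∈-insertions⁻ []           (here refl) = ↭-refl
  ∈-insertions⁻ (y ∷ ys)     (here refl) = ↭-refl
  ∈-insertions⁻ {x} (y ∷ ys) (there o∈) with ∈-map⁻ (y ∷_) o∈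
  ... | _ , o′∈ , refl = ↭-trans (prep y (∈-insertions⁻ ys o′∈)) (swap y x ↭-refl)

  ∈-insertions⁺ : ∀ (x : A) ys zs → ys ++ x ∷ zs ∈ insertions x (ys ++ zs)
  ∈-insertions⁺ x []       []      = here refl
  ∈-insertions⁺ x []       (_ ∷ _) = here refl
  ∈-insertions⁺ x (y ∷ ys) zs      = there (∈-map⁺ (y ∷_) (∈-insertions⁺ x ys zs))

  ∈-perms⁻ : ∀ {o} xs → o ∈ perms xs → o ↭ xs
  ∈-perms⁻ []       (here refl) = ↭-refl
  ∈-perms⁻ (x ∷ xs) o∈ with find (∈-concatMap⁻ (insertions x) {xs = perms xs} o∈)
  ... | p , p∈ , o∈p = ↭-trans (∈-insertions⁻ p o∈p) (prep x (∈-perms⁻ xs p∈))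

  ∈-perms⁺ : ∀ {o} xs → o ↭ xs → o ∈ perms xs
  ∈-perms⁺ []       o↭ rewrite ↭-empty-inv o↭ = here refl
  ∈-perms⁺ (x ∷ xs) o↭ with ∈-∃++ (∈-resp-↭ (↭-sym o↭) (here refl))
  ... | ys , zs , refl = ∈-concatMap⁺ (insertions x) {xs = perms xs}
                           (lose (∈-perms⁺ xs (drop-mid ys [] o↭)) (∈-insertions⁺ x ys zs))

  insertions-unique : ∀ {x : A} xs → x ∉ xs → Unique (insertions x xs)
  insertions-unique []           _  = [] ∷ []
  insertions-unique {x} (y ∷ ys) x∉ =
    All.tabulate head-fresh ∷ Unique.map⁺ ∷-injectiveʳ (insertions-unique ys (x∉ ∘ there))
    where
    head-fresh : ∀ {o} → o ∈ map (y ∷_) (insertions x ys) → x ∷ y ∷ ys ≢ o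
    head-fresh o∈ eq with ∈-map⁻ (y ∷_) o∈
    ... | _ , _ , refl = x∉ (here (∷-injectiveˡ eq))

  module _ (_≟_ : DecidableEquality A) where

    erase : A → List A → List A
    erase x = filter (λ y → ¬? (x ≟ y))

    erase-insertions : ∀ {x o} xs → x ∉ xs → o ∈ insertions x xs → erase x o ≡ xs
    erase-insertions {x} []       _  (here refl) = filter-reject (¬? ∘ (x ≟_)) (λ x≢x → x≢x refl)
    erase-insertions {x} (y ∷ ys) x∉ (here refl) =
      trans (filter-reject (¬? ∘ (x ≟_)) (λ x≢x → x≢x refl))
            (filter-all (¬? ∘ (x ≟_)) (¬Any⇒All¬ (y ∷ ys) x∉))
    erase-insertions {x} (y ∷ ys) x∉ (there o∈) with ∈-map⁻ (y ∷_) o∈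
    ... | _ , o′∈ , refl =
      trans (filter-accept (¬? ∘ (x ≟_)) (x∉ ∘ here))
            (cong (y ∷_) (erase-insertions ys (x∉ ∘ there) o′∈))

    concatMap-insertions-unique : ∀ {x} pss → Unique pss → (∀ {p} → p ∈ pss → x ∉ p) →
                                  Unique (concatMap (insertions x) pss)
    concatMap-insertions-unique []            _            _  = []
    concatMap-insertions-unique {x} (p ∷ pss) (p∉ ∷ pss!) x∉ =
      Unique.++⁺ (insertions-unique p (x∉ (here refl)))
                 (concatMap-insertions-unique pss pss! (x∉ ∘ there)) disjoint
      where
      disjoint : ∀ {o} → ¬ (o ∈ insertions x p × o ∈ concatMap (insertions x) pss)
      disjoint (o∈p , o∈pss) with find (∈-concatMap⁻ (insertions x) {xs = pss} o∈pss)
      ... | p′ , p′∈ , o∈p′ = All.lookup p∉ p′∈ (trans (sym (erase-insertions p (x∉ (here refl)) o∈p))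
                                                        (erase-insertions p′ (x∉ (there p′∈)) o∈p′))

    perms-unique : ∀ {xs} → Unique xs → Unique (perms xs)
    perms-unique {[]}     _          = [] ∷ []
    perms-unique {x ∷ xs} (x∉ ∷ xs!) = concatMap-insertions-unique (perms xs) (perms-unique xs!)
      (λ p∈ x∈p → All.lookup x∉ (∈-resp-↭ (∈-perms⁻ xs p∈) x∈p) refl)

module _ {B : Set} where

  iterate-suc : ∀ (f : B → B) x m → f (iterate f x m) ≡ iterate f x (suc m)
  iterate-suc f x m = trans (cong f (sym (iterate-is-fold x f m))) (iterate-is-fold x f (suc m))

  map-↭-periodic : ∀ {ρ : B → B} {xs} m → Unique xs → (∀ {x} → x ∈ xs → ρ x ∈ xs) →
                   (∀ {x} → x ∈ xs → iterate ρ x (suc m) ≡ x) → map ρ xs ↭ xs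
  map-↭-periodic {ρ} {xs} m xs! ρ∈ periodic = ∼bag⇒↭ (unique∧set⇒bag ρxs! xs! (mk⇔ to from))
    where
    iterate-∈ : ∀ i {x} → x ∈ xs → iterate ρ x i ∈ xs
    iterate-∈ zero    x∈ = x∈
    iterate-∈ (suc i) x∈ = iterate-∈ i (ρ∈ x∈)

    ρxs! : Unique (map ρ xs)
    ρxs! = Unique.map⁻ {f = λ x → iterate ρ x m}
      (subst Unique (sym (trans (sym (map-∘ xs)) (map-id-local (All.tabulate periodic)))) xs!)

    to : ∀ {x} → x ∈ map ρ xs → x ∈ xs
    to x∈ with ∈-map⁻ ρ x∈
    ... | _ , y∈ , refl = ρ∈ y∈

    from : ∀ {x} → x ∈ xs → x ∈ map ρ xs
    from {x} x∈ = subst (_∈ map ρ xs) (trans (iterate-suc ρ x m) (periodic x∈))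
                        (∈-map⁺ ρ (iterate-∈ m x∈))

-- Natural numbers as rationals

ℕtoℚ≡mkℚ : ∀ a → ℕtoℚ a ≡ mkℚ (+ a) 0 (Coprime.sym (1-coprimeTo a))
ℕtoℚ≡mkℚ a = normalize-coprime (Coprime.sym (1-coprimeTo a))

-- normalize a 1 is stuck for a variable a; in coprime form _+_ unfolds to the fraction below.
ℕtoℚ-+ : ∀ a b → ℕtoℚ (a ℕ.+ b) ≡ ℕtoℚ a + ℕtoℚ b
ℕtoℚ-+ a b = sym (begin
  ℕtoℚ a + ℕtoℚ b                    ≡⟨ cong₂ _+_ (ℕtoℚ≡mkℚ a) (ℕtoℚ≡mkℚ b) ⟩
  (+ a ℤ.* + 1 ℤ.+ + b ℤ.* + 1) / 1  ≡⟨ cong₂ (λ i j → (i ℤ.+ j) / 1) (ℤ.*-identityʳ (+ a)) (ℤ.*-identityʳ (+ b)) ⟩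
  ℕtoℚ (a ℕ.+ b)                     ∎)
  where open ≡-Reasoning

ℕtoℚ-suc : ∀ a → ℕtoℚ (suc a) ≡ 1ℚ + ℕtoℚ a
ℕtoℚ-suc = ℕtoℚ-+ 1

+-ℕtoℚ-suc-* : ∀ a b i → a + ℕtoℚ (suc i) * b ≡ b + (a + ℕtoℚ i * b)
+-ℕtoℚ-suc-* a b i = trans (cong (λ x → a + x * b) (ℕtoℚ-suc i))
  (solve 3 (λ a b x → a :+ (con 1ℚ :+ x) :* b := b :+ (a :+ x :* b)) refl a b (ℕtoℚ i))

ℕtoℚ-nonNeg : ∀ a → 0ℚ ≤ ℕtoℚ a
ℕtoℚ-nonNeg a = nonNegative⁻¹ (ℕtoℚ a) {{normalize-nonNeg a 1}}

ℕtoℚ-mono : ∀ {a b} → a ℕ.≤ b → ℕtoℚ a ≤ ℕtoℚ b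
ℕtoℚ-mono {a} {b} a≤b = begin
  ℕtoℚ a                   ≡⟨ +-identityʳ (ℕtoℚ a) ⟨
  ℕtoℚ a + 0ℚ              ≤⟨ +-monoʳ-≤ (ℕtoℚ a) (ℕtoℚ-nonNeg (b ℕ.∸ a)) ⟩
  ℕtoℚ a + ℕtoℚ (b ℕ.∸ a)  ≡⟨ ℕtoℚ-+ a (b ℕ.∸ a) ⟨
  ℕtoℚ (a ℕ.+ (b ℕ.∸ a))   ≡⟨ cong ℕtoℚ (ℕ.m+[n∸m]≡n a≤b) ⟩
  ℕtoℚ b                   ∎
  where open ≤-Reasoning

1/suc-inverse : ∀ m → (+ 1 / suc m) * ℕtoℚ (suc m) ≡ 1ℚ
1/suc-inverse m = trans (cong₂ _*_ (normalize-coprime (1-coprimeTo (suc m))) (ℕtoℚ≡mkℚ (suc m)))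
                        (*-inverseˡ (mkℚ (+ suc m) 0 (Coprime.sym (1-coprimeTo (suc m)))))

p≤q⇒0≤q-p : ∀ {p q} → p ≤ q → 0ℚ ≤ q - p
p≤q⇒0≤q-p {p} {q} p≤q = ≤-trans (≤-reflexive (sym (+-inverseʳ p))) (+-monoˡ-≤ (- p) p≤q)

weight-shift : ∀ {c K} l b b′ → c ≤ K → b ≤ b′ →
               (K - 1ℚ) * b + (l - K) * b′ ≤ (c - 1ℚ) * b + (l - c) * b′
weight-shift {c} {K} l b b′ c≤K b≤b′ = begin
  W                         ≡⟨ +-identityʳ W ⟨
  W + 0ℚ                    ≤⟨ +-monoʳ-≤ W 0≤[K-c][b′-b] ⟩
  W + (K - c) * (b′ - b)    ≡⟨ solve 5 (λ c K l b b′ →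
                                 (K :- con 1ℚ) :* b :+ (l :- K) :* b′ :+ (K :- c) :* (b′ :- b)
                                 := (c :- con 1ℚ) :* b :+ (l :- c) :* b′) refl c K l b b′ ⟩
  (c - 1ℚ) * b + (l - c) * b′ ∎
  where
  open ≤-Reasoning
  W = (K - 1ℚ) * b + (l - K) * b′
  0≤[K-c][b′-b] : 0ℚ ≤ (K - c) * (b′ - b)
  0≤[K-c][b′-b] = ≤-trans (≤-reflexive (sym (*-zeroʳ (K - c))))
    (*-monoˡ-≤-nonNeg (K - c) {{nonNegative (p≤q⇒0≤q-p c≤K)}} (p≤q⇒0≤q-p b≤b′))

-- Sums and means

sumℚ-↭ : ∀ {xs ys} → xs ↭ ys → sumℚ xs ≡ sumℚ ys
sumℚ-↭ = Permutationₛ.foldr-commMonoid (setoid ℚ) +-0-isCommutativeMonoid ∘ ↭⇒↭ₛ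

mean-↭ : ∀ {xs ys} → xs ↭ ys → mean xs ≡ mean ys
mean-↭ {[]}    {[]}    _   = refl
mean-↭ {[]}    {_ ∷ _} xs↭ with () ← ↭-length xs↭
mean-↭ {_ ∷ _} {[]}    xs↭ with () ← ↭-length xs↭
mean-↭ {_ ∷ _} {_ ∷ _} xs↭ =
  cong₂ (λ s l → s * (+ 1 / suc l)) (sumℚ-↭ xs↭) (ℕ.suc-injective (↭-length xs↭))

module _ {B : Set} where

  sum-map-+ : ∀ (f g : B → ℚ) xs →
              sumℚ (map (λ x → f x + g x) xs) ≡ sumℚ (map f xs) + sumℚ (map g xs)
  sum-map-+ f g []       = refl
  sum-map-+ f g (x ∷ xs) = trans (cong (_+_ (f x + g x)) (sum-map-+ f g xs))
                                 (interchange (f x) (g x) (sumℚ (map f xs)) (sumℚ (map g xs)))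

  sum-map-* : ∀ c (f : B → ℚ) xs → sumℚ (map (λ x → c * f x) xs) ≡ c * sumℚ (map f xs)
  sum-map-* c f []       = sym (*-zeroʳ c)
  sum-map-* c f (x ∷ xs) = trans (cong (_+_ (c * f x)) (sum-map-* c f xs))
                                 (sym (*-distribˡ-+ c (f x) (sumℚ (map f xs))))

  sum-map-mono : ∀ {f g : B → ℚ} xs → (∀ {x} → x ∈ xs → f x ≤ g x) →
                 sumℚ (map f xs) ≤ sumℚ (map g xs)
  sum-map-mono []       _   = ≤-refl
  sum-map-mono (x ∷ xs) f≤g = +-mono-≤ (f≤g (here refl)) (sum-map-mono xs (f≤g ∘ there))

  sum-map-if : ∀ (p : B → Bool) (g : B → ℚ) c xs →
               sumℚ (map (λ x → if p x then g x else c) xs) + ℕtoℚ (length (filterᵇ p xs)) * c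
               ≡ sumℚ (map g (filterᵇ p xs)) + ℕtoℚ (length xs) * c
  sum-map-if p g c []       = refl
  sum-map-if p g c (x ∷ xs) with p x | sum-map-if p g c xs
  ... | true  | ih = begin
    (g x + S) + ℕtoℚ (suc k) * c   ≡⟨ +-assoc (g x) S (ℕtoℚ (suc k) * c) ⟩
    g x + (S + ℕtoℚ (suc k) * c)   ≡⟨ cong (_+_ (g x)) (+-ℕtoℚ-suc-* S c k) ⟩
    g x + (c + (S + ℕtoℚ k * c))   ≡⟨ cong (λ z → g x + (c + z)) ih ⟩
    g x + (c + (S′ + ℕtoℚ l * c))  ≡⟨ cong (_+_ (g x)) (+-ℕtoℚ-suc-* S′ c l) ⟨
    g x + (S′ + ℕtoℚ (suc l) * c)  ≡⟨ +-assoc (g x) S′ (ℕtoℚ (suc l) * c) ⟨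
    (g x + S′) + ℕtoℚ (suc l) * c  ∎
    where
    open ≡-Reasoning
    S = sumℚ (map (λ x → if p x then g x else c) xs)
    S′ = sumℚ (map g (filterᵇ p xs))
    k = length (filterᵇ p xs)
    l = length xs
  ... | false | ih = begin
    (c + S) + ℕtoℚ k * c           ≡⟨ +-assoc c S (ℕtoℚ k * c) ⟩
    c + (S + ℕtoℚ k * c)           ≡⟨ cong (_+_ c) ih ⟩
    c + (S′ + ℕtoℚ l * c)          ≡⟨ +-ℕtoℚ-suc-* S′ c l ⟨
    S′ + ℕtoℚ (suc l) * c          ∎
    where
    open ≡-Reasoning
    S = sumℚ (map (λ x → if p x then g x else c) xs)
    S′ = sumℚ (map g (filterᵇ p xs))
    k = length (filterᵇ p xs)
    l = length xs

  mean-map-∷ : ∀ (f : B → ℚ) x xs →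
               mean (map f (x ∷ xs)) ≡ sumℚ (map f (x ∷ xs)) * (+ 1 / suc (length xs))
  mean-map-∷ f x xs = cong (λ l → sumℚ (map f (x ∷ xs)) * (+ 1 / suc l)) (length-map f xs)

  mean-map-+ : ∀ (f g : B → ℚ) xs →
               mean (map (λ x → f x + g x) xs) ≡ mean (map f xs) + mean (map g xs)
  mean-map-+ f g []       = refl
  mean-map-+ f g (x ∷ xs) = begin
    mean (map (λ x → f x + g x) (x ∷ xs))  ≡⟨ mean-map-∷ (λ x → f x + g x) x xs ⟩
    sumℚ (map (λ x → f x + g x) (x ∷ xs)) * w ≡⟨ cong (_* w) (sum-map-+ f g (x ∷ xs)) ⟩
    (F + G) * w                            ≡⟨ *-distribʳ-+ w F G ⟩
    F * w + G * w                          ≡⟨ cong₂ _+_ (mean-map-∷ f x xs) (mean-map-∷ g x xs) ⟨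
    mean (map f (x ∷ xs)) + mean (map g (x ∷ xs)) ∎
    where
    open ≡-Reasoning
    w = + 1 / suc (length xs)
    F = sumℚ (map f (x ∷ xs))
    G = sumℚ (map g (x ∷ xs))

  mean-map-* : ∀ c (f : B → ℚ) xs → mean (map (λ x → c * f x) xs) ≡ c * mean (map f xs)
  mean-map-* c f []       = sym (*-zeroʳ c)
  mean-map-* c f (x ∷ xs) = begin
    mean (map (λ x → c * f x) (x ∷ xs))      ≡⟨ mean-map-∷ (λ x → c * f x) x xs ⟩
    sumℚ (map (λ x → c * f x) (x ∷ xs)) * w  ≡⟨ cong (_* w) (sum-map-* c f (x ∷ xs)) ⟩
    c * sumℚ (map f (x ∷ xs)) * w            ≡⟨ *-assoc c (sumℚ (map f (x ∷ xs))) w ⟩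
    c * (sumℚ (map f (x ∷ xs)) * w)          ≡⟨ cong (c *_) (mean-map-∷ f x xs) ⟨
    c * mean (map f (x ∷ xs))                ∎
    where
    open ≡-Reasoning
    w = + 1 / suc (length xs)

  mean-map-mono : ∀ {f g : B → ℚ} xs → (∀ {x} → x ∈ xs → f x ≤ g x) →
                  mean (map f xs) ≤ mean (map g xs)
  mean-map-mono         []       _   = ≤-refl
  mean-map-mono {f} {g} (x ∷ xs) f≤g = begin
    mean (map f (x ∷ xs))      ≡⟨ mean-map-∷ f x xs ⟩
    sumℚ (map f (x ∷ xs)) * w  ≤⟨ *-monoʳ-≤-nonNeg w {{normalize-nonNeg 1 (suc (length xs))}}
                                                    (sum-map-mono (x ∷ xs) f≤g) ⟩
    sumℚ (map g (x ∷ xs)) * w  ≡⟨ mean-map-∷ g x xs ⟨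
    mean (map g (x ∷ xs))      ∎
    where
    open ≤-Reasoning
    w = + 1 / suc (length xs)

  mean-map-∘ : ∀ {ρ : B → B} {xs} (f : B → ℚ) → map ρ xs ↭ xs →
               mean (map (f ∘ ρ) xs) ≡ mean (map f xs)
  mean-map-∘ {ρ} {xs} f ρxs↭xs = trans (cong mean (map-∘ xs)) (mean-↭ (map⁺ f ρxs↭xs))

  orbitSum : (B → B) → (B → ℚ) → ℕ → B → ℚ
  orbitSum ρ f i x = sumℚ (map f (List.iterate ρ (ρ x) i))

  mean-orbitSum : ∀ {ρ : B → B} {xs} (f : B → ℚ) → map ρ xs ↭ xs →
                  ∀ i → mean (map (orbitSum ρ f i) xs) ≡ ℕtoℚ i * mean (map f xs)
  mean-orbitSum {xs = xs} f _ zero =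
    trans (cong mean (map-cong (λ x → sym (*-zeroˡ (f x))) xs)) (mean-map-* 0ℚ f xs)
  mean-orbitSum {ρ} {xs} f ρxs↭xs (suc i) = begin
    mean (map (λ x → f (ρ x) + orbitSum ρ f i (ρ x)) xs)
      ≡⟨ mean-map-+ (f ∘ ρ) (orbitSum ρ f i ∘ ρ) xs ⟩
    mean (map (f ∘ ρ) xs) + mean (map (orbitSum ρ f i ∘ ρ) xs)
      ≡⟨ cong₂ _+_ (mean-map-∘ f ρxs↭xs) (mean-map-∘ (orbitSum ρ f i) ρxs↭xs) ⟩
    M + mean (map (orbitSum ρ f i) xs)
      ≡⟨ cong (_+_ M) (mean-orbitSum f ρxs↭xs i) ⟩
    M + ℕtoℚ i * M
      ≡⟨ solve 2 (λ M I → M :+ I :* M := (con 1ℚ :+ I) :* M) refl M (ℕtoℚ i) ⟩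
    (1ℚ + ℕtoℚ i) * M
      ≡⟨ cong (_* M) (ℕtoℚ-suc i) ⟨
    ℕtoℚ (suc i) * M ∎
    where
    open ≡-Reasoning
    M = mean (map f xs)

-- Rotating a prefix

module _ {A : Set} where

  rotate : List A → List A
  rotate []       = []
  rotate (x ∷ xs) = xs ++ x ∷ []

  length-rotate : ∀ (xs : List A) → length (rotate xs) ≡ length xs
  length-rotate []       = refl
  length-rotate (x ∷ xs) = trans (length-++ xs) (ℕ.+-comm (length xs) 1)

  rotate-↭ : ∀ (xs : List A) → rotate xs ↭ xs
  rotate-↭ []       = ↭-refl
  rotate-↭ (x ∷ xs) = ++-comm xs (x ∷ [])

  iterate-rotate-++ : ∀ (xs ys : List A) → iterate rotate (xs ++ ys) (length xs) ≡ ys ++ xs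
  iterate-rotate-++ []       ys = sym (++-identityʳ ys)
  iterate-rotate-++ (x ∷ xs) ys = begin
    iterate rotate ((xs ++ ys) ++ x ∷ []) (length xs)
      ≡⟨ cong (λ zs → iterate rotate zs (length xs)) (++-assoc xs ys (x ∷ [])) ⟩
    iterate rotate (xs ++ ys ++ x ∷ []) (length xs)
      ≡⟨ iterate-rotate-++ xs (ys ++ x ∷ []) ⟩
    (ys ++ x ∷ []) ++ xs
      ≡⟨ ++-assoc ys (x ∷ []) xs ⟩
    ys ++ x ∷ xs ∎
    where open ≡-Reasoning

  take-length-++ : ∀ (xs ys : List A) → take (length xs) (xs ++ ys) ≡ xs
  take-length-++ []       ys = refl
  take-length-++ (x ∷ xs) ys = cong (x ∷_) (take-length-++ xs ys)

  drop-length-++ : ∀ (xs ys : List A) → drop (length xs) (xs ++ ys) ≡ ys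
  drop-length-++ []       ys = refl
  drop-length-++ (x ∷ xs) ys = drop-length-++ xs ys

  length-take-≤ : ∀ ℓ (xs : List A) → ℓ ℕ.≤ length xs → length (take ℓ xs) ≡ ℓ
  length-take-≤ ℓ xs ℓ≤ = trans (length-take ℓ xs) (ℕ.m≤n⇒m⊓n≡m ℓ≤)

  rotatePrefix : ℕ → List A → List A
  rotatePrefix ℓ xs = rotate (take ℓ xs) ++ drop ℓ xs

  rotatePrefix-↭ : ∀ ℓ (xs : List A) → rotatePrefix ℓ xs ↭ xs
  rotatePrefix-↭ ℓ xs =
    ↭-trans (++⁺ʳ (drop ℓ xs) (rotate-↭ (take ℓ xs))) (↭-reflexive (take++drop≡id ℓ xs))

  rotatePrefix-++ : ∀ {ℓ} (xs ys : List A) → length xs ≡ ℓ →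
                    rotatePrefix ℓ (xs ++ ys) ≡ rotate xs ++ ys
  rotatePrefix-++ xs ys refl =
    cong₂ (λ us vs → rotate us ++ vs) (take-length-++ xs ys) (drop-length-++ xs ys)

  iterate-rotatePrefix-++ : ∀ {ℓ} (xs ys : List A) i → length xs ≡ ℓ →
                            iterate (rotatePrefix ℓ) (xs ++ ys) i ≡ iterate rotate xs i ++ ys
  iterate-rotatePrefix-++     xs ys zero    _    = refl
  iterate-rotatePrefix-++ {ℓ} xs ys (suc i) ∣xs∣ =
    trans (cong (λ zs → iterate (rotatePrefix ℓ) zs i) (rotatePrefix-++ xs ys ∣xs∣))
          (iterate-rotatePrefix-++ (rotate xs) ys i (trans (length-rotate xs) ∣xs∣))

  rotatePrefix-periodic : ∀ ℓ (xs : List A) → ℓ ℕ.≤ length xs → iterate (rotatePrefix ℓ) xs ℓ ≡ xs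
  rotatePrefix-periodic ℓ xs ℓ≤ = begin
    iterate (rotatePrefix ℓ) xs ℓ             ≡⟨ cong (λ zs → iterate (rotatePrefix ℓ) zs ℓ) (take++drop≡id ℓ xs) ⟨
    iterate (rotatePrefix ℓ) (q ++ r) ℓ       ≡⟨ iterate-rotatePrefix-++ q r ℓ ∣q∣ ⟩
    iterate rotate q ℓ ++ r                   ≡⟨ cong (λ i → iterate rotate q i ++ r) ∣q∣ ⟨
    iterate rotate q (length q) ++ r          ≡⟨ cong (λ zs → iterate rotate zs (length q) ++ r) (++-identityʳ q) ⟨
    iterate rotate (q ++ []) (length q) ++ r  ≡⟨ cong (_++ r) (iterate-rotate-++ q []) ⟩
    q ++ r                                    ≡⟨ take++drop≡id ℓ xs ⟩
    xs                                        ∎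
    where
    open ≡-Reasoning
    q = take ℓ xs
    r = drop ℓ xs
    ∣q∣ = length-take-≤ ℓ xs ℓ≤

-- Arrival orders

module _ {n : ℕ} where

  orders-unique : Unique (orders n)
  orders-unique = perms-unique Fin._≟_ (Unique.allFin⁺ n)

  ∈-orders⁻ : ∀ {o} → o ∈ orders n → o ↭ allFin n
  ∈-orders⁻ = ∈-perms⁻ (allFin n)

  ∈-orders⁺ : ∀ {o} → o ↭ allFin n → o ∈ orders n
  ∈-orders⁺ = ∈-perms⁺ (allFin n)

  length-∈-orders : ∀ {o} → o ∈ orders n → length o ≡ n
  length-∈-orders o∈ = trans (↭-length (∈-orders⁻ o∈)) (length-tabulate (λ i → i))

  unique-∈-orders : ∀ {o} → o ∈ orders n → Unique o
  unique-∈-orders o∈ =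
    Permutationₛ.Unique-resp-↭ (setoid (Fin n)) (↭⇒↭ₛ (↭-sym (∈-orders⁻ o∈))) (Unique.allFin⁺ n)

  rotatePrefix-permutes-orders : ∀ {m} → m < n → map (rotatePrefix (suc m)) (orders n) ↭ orders n
  rotatePrefix-permutes-orders {m} m<n = map-↭-periodic m orders-unique
    (λ {o} o∈ → ∈-orders⁺ (↭-trans (rotatePrefix-↭ (suc m) o) (∈-orders⁻ o∈)))
    (λ {o} o∈ → rotatePrefix-periodic (suc m) o (subst (suc m ℕ.≤_) (sym (length-∈-orders o∈)) m<n))

-- Subsets and submodular functions

module _ {n : ℕ} where

  ∪-monoʳ-⊆ : ∀ (p : Subset n) {q r} → q ⊆ r → p ∪ q ⊆ p ∪ r
  ∪-monoʳ-⊆ p {q} q⊆r x∈ = x∈p∪q⁺ (Sum.map₂ q⊆r (x∈p∪q⁻ p q x∈))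

  ∪-distribʳ-∪ : ∀ (p q r : Subset n) → (q ∪ r) ∪ p ≡ (q ∪ p) ∪ (r ∪ p)
  ∪-distribʳ-∪ = ∙-distrʳ-∙ (∪-idempotentCommutativeMonoid n)

  ∈⇒T-lookup : ∀ {p : Subset n} {x} → x ∈ₛ p → T (lookup p x)
  ∈⇒T-lookup x∈ = Equivalence.from T-≡ ([]=⇒lookup x∈)

  T-lookup⇒∈ : ∀ {p : Subset n} {x} → T (lookup p x) → x ∈ₛ p
  T-lookup⇒∈ {p} {x} t = lookup⇒[]= x p (Equivalence.to T-≡ t)

  ∈-setOf⁺ : ∀ {x : Fin n} {xs} → x ∈ xs → x ∈ₛ setOf xs
  ∈-setOf⁺ {xs = y ∷ _} (here refl) = x∈p∪q⁺ (inj₁ (x∈⁅x⁆ y))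
  ∈-setOf⁺ {xs = y ∷ _} (there x∈)  = x∈p∪q⁺ (inj₂ (∈-setOf⁺ x∈))

  ∈-setOf⁻ : ∀ {x : Fin n} xs → x ∈ₛ setOf xs → x ∈ xs
  ∈-setOf⁻ []       x∈ = ⊥-elim (∉⊥ x∈)
  ∈-setOf⁻ (y ∷ ys) x∈ with x∈p∪q⁻ ⁅ y ⁆ (setOf ys) x∈
  ... | inj₁ x∈y  = here (x∈⁅y⁆⇒x≡y y x∈y)
  ... | inj₂ x∈ys = there (∈-setOf⁻ ys x∈ys)

  setOf-↭ : ∀ {xs ys : List (Fin n)} → xs ↭ ys → setOf xs ≡ setOf ys
  setOf-↭ {xs} {ys} xs↭ys = ⊆-antisym (∈-setOf⁺ ∘ ∈-resp-↭ xs↭ys ∘ ∈-setOf⁻ xs)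
                                      (∈-setOf⁺ ∘ ∈-resp-↭ (↭-sym xs↭ys) ∘ ∈-setOf⁻ ys)

  length≤∣setOf∣ : ∀ {xs : List (Fin n)} → Unique xs → length xs ℕ.≤ ∣ setOf xs ∣
  length≤∣setOf∣          []         = ℕ.z≤n
  length≤∣setOf∣ {x ∷ xs} (x∉ ∷ xs!) =
    ℕ.≤-trans (ℕ.s≤s (length≤∣setOf∣ xs!))
              (p⊂q⇒∣p∣<∣q∣ (q⊆p∪q ⁅ x ⁆ (setOf xs) , x , x∈p∪q⁺ (inj₁ (x∈⁅x⁆ x)) , x∉xs))
    where
    x∉xs : x ∉ₛ setOf xs
    x∉xs x∈ = All.lookup x∉ (∈-setOf⁻ xs x∈) refl

module _ {n : ℕ} {v : Subset n → ℚ} (mono : Monotone v) (sub : Submodular v) where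

  marginal-subadditive : ∀ J S B → v ((J ∪ S) ∪ B) + v B ≤ v (J ∪ B) + v (S ∪ B)
  marginal-subadditive J S B = begin
    v ((J ∪ S) ∪ B) + v B                          ≡⟨ cong (λ X → v X + v B) (∪-distribʳ-∪ B J S) ⟩
    v ((J ∪ B) ∪ (S ∪ B)) + v B                    ≤⟨ +-monoʳ-≤ (v ((J ∪ B) ∪ (S ∪ B))) (mono B _ B⊆) ⟩
    v ((J ∪ B) ∪ (S ∪ B)) + v ((J ∪ B) ∩ (S ∪ B))  ≤⟨ sub (J ∪ B) (S ∪ B) ⟩
    v (J ∪ B) + v (S ∪ B)                          ∎
    where
    open ≤-Reasoning
    B⊆ : B ⊆ (J ∪ B) ∩ (S ∪ B)
    B⊆ = subst (B ⊆_) (∪-distribʳ-∩ B J S) (q⊆p∪q (J ∩ S) B)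

  submodular-union-bound : ∀ B xs →
    v (setOf xs ∪ B) + ℕtoℚ (length xs) * v B ≤ sumℚ (map (λ j → v (⁅ j ⁆ ∪ B)) xs) + v B
  submodular-union-bound B [] = ≤-reflexive (begin
    v (setOf [] ∪ B) + 0ℚ * v B  ≡⟨ cong₂ _+_ (cong v (∪-identityˡ B)) (*-zeroˡ (v B)) ⟩
    v B + 0ℚ                     ≡⟨ +-identityʳ (v B) ⟩
    v B                          ≡⟨ +-identityˡ (v B) ⟨
    0ℚ + v B                     ∎)
    where open ≡-Reasoning
  submodular-union-bound B (j ∷ xs) = begin
    v (J ∪ B) + ℕtoℚ (suc (length xs)) * v B   ≡⟨ cong (λ i → v (J ∪ B) + i * v B) (ℕtoℚ-suc (length xs)) ⟩
    v (J ∪ B) + (1ℚ + L) * v B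
      ≡⟨ solve 3 (λ x b l → x :+ (con 1ℚ :+ l) :* b := (x :+ b) :+ l :* b) refl (v (J ∪ B)) (v B) L ⟩
    (v (J ∪ B) + v B) + L * v B                ≤⟨ +-monoˡ-≤ (L * v B) (marginal-subadditive ⁅ j ⁆ S B) ⟩
    (v (⁅ j ⁆ ∪ B) + v (S ∪ B)) + L * v B      ≡⟨ +-assoc (v (⁅ j ⁆ ∪ B)) (v (S ∪ B)) (L * v B) ⟩
    v (⁅ j ⁆ ∪ B) + (v (S ∪ B) + L * v B)      ≤⟨ +-monoʳ-≤ (v (⁅ j ⁆ ∪ B)) (submodular-union-bound B xs) ⟩
    v (⁅ j ⁆ ∪ B) + (Σ + v B)                  ≡⟨ +-assoc (v (⁅ j ⁆ ∪ B)) Σ (v B) ⟨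
    (v (⁅ j ⁆ ∪ B) + Σ) + v B                  ∎
    where
    open ≤-Reasoning
    S = setOf xs
    J = ⁅ j ⁆ ∪ S
    L = ℕtoℚ (length xs)
    Σ = sumℚ (map (λ j → v (⁅ j ⁆ ∪ B)) xs)

  capacity-bound : ∀ {k} (a B B′ : Subset n) xs → Unique xs → a ⊆ setOf xs → ∣ a ∣ ℕ.≤ k → B ⊆ B′ →
    v a + (ℕtoℚ k - 1ℚ) * v B + (ℕtoℚ (length xs) - ℕtoℚ k) * v B′
      ≤ sumℚ (map (λ j → v (if lookup a j then ⁅ j ⁆ ∪ B else B′)) xs)
  capacity-bound {k} a B B′ xs xs! a⊆xs ∣a∣≤k B⊆B′ = begin
    v a + (K - 1ℚ) * b + (l - K) * b′
      ≡⟨ +-assoc (v a) ((K - 1ℚ) * b) ((l - K) * b′) ⟩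
    v a + ((K - 1ℚ) * b + (l - K) * b′)
      ≤⟨ +-mono-≤ (mono a (setOf p ∪ B) a⊆p∪B) (weight-shift l b b′ c≤K (mono B B′ B⊆B′)) ⟩
    t + ((c - 1ℚ) * b + (l - c) * b′)
      ≡⟨ solve 5 (λ t b b′ c l → t :+ ((c :- con 1ℚ) :* b :+ (l :- c) :* b′)
                                 := (t :+ c :* b) :+ ((l :- c) :* b′ :- b)) refl t b b′ c l ⟩
    (t + c * b) + ((l - c) * b′ - b)
      ≤⟨ +-monoˡ-≤ ((l - c) * b′ - b) (submodular-union-bound B p) ⟩
    (S + b) + ((l - c) * b′ - b)
      ≡⟨ solve 5 (λ S b b′ c l → (S :+ b) :+ ((l :- c) :* b′ :- b) := (S :+ l :* b′) :- c :* b′)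
                 refl S b b′ c l ⟩
    (S + l * b′) - c * b′
      ≡⟨ cong (_- c * b′) (sum-map-if (lookup a) (λ j → v (⁅ j ⁆ ∪ B)) b′ xs) ⟨
    (Σ + c * b′) - c * b′
      ≡⟨ solve 3 (λ Σ c b′ → (Σ :+ c :* b′) :- c :* b′ := Σ) refl Σ c b′ ⟩
    Σ
      ≡⟨ cong sumℚ (map-cong (λ j → if-float v (lookup a j)) xs) ⟨
    sumℚ (map (λ j → v (if lookup a j then ⁅ j ⁆ ∪ B else B′)) xs) ∎
    where
    open ≤-Reasoning
    p = filterᵇ (lookup a) xs
    c = ℕtoℚ (length p)
    K = ℕtoℚ k
    l = ℕtoℚ (length xs)
    b = v B
    b′ = v B′
    t = v (setOf p ∪ B)
    S = sumℚ (map (λ j → v (⁅ j ⁆ ∪ B)) p)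
    Σ = sumℚ (map (λ j → if lookup a j then v (⁅ j ⁆ ∪ B) else b′) xs)

    a⊆p∪B : a ⊆ setOf p ∪ B
    a⊆p∪B x∈a = x∈p∪q⁺ (inj₁ (∈-setOf⁺
      (∈-filter⁺ (T? ∘ lookup a) (∈-setOf⁻ xs (a⊆xs x∈a)) (∈⇒T-lookup x∈a))))

    p⊆a : setOf p ⊆ a
    p⊆a x∈ = T-lookup⇒∈ (proj₂ (∈-filter⁻ (T? ∘ lookup a) {xs = xs} (∈-setOf⁻ p x∈)))

    c≤K : c ≤ K
    c≤K = ℕtoℚ-mono (ℕ.≤-trans (length≤∣setOf∣ (Unique.filter⁺ (T? ∘ lookup a) xs!))
                               (ℕ.≤-trans (p⊆q⇒∣p∣≤∣q∣ p⊆a) ∣a∣≤k))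

-- The online algorithm

module _ {n : ℕ} (A : Subset n → Subset n) where

  run-⊆-suc : ∀ S r s → run A S r s ⊆ run A S r (suc s)
  run-⊆-suc S []      s       x∈ = x∈
  run-⊆-suc S (j ∷ r) zero    x∈ = ⊥-elim (∉⊥ x∈)
  run-⊆-suc S (j ∷ r) (suc s) with lookup (A (⁅ j ⁆ ∪ S)) j
  ... | true  = ∪-monoʳ-⊆ ⁅ j ⁆ (run-⊆-suc (⁅ j ⁆ ∪ S) r s)
  ... | false = run-⊆-suc (⁅ j ⁆ ∪ S) r (suc s)

  -- ALG^{≥ℓ}_{s+1} when U^{≤ℓ} = L, the item j arrives in round ℓ and r arrives afterwards.
  ALG≥-from : ℕ → Subset n → List (Fin n) → Fin n → Subset n
  ALG≥-from s L r j = if lookup (A L) j then ⁅ j ⁆ ∪ run A L r s else run A L r (suc s)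

  ALG≥-last : ∀ {m} s u y r → length u ≡ m →
              ALG≥ A (u ++ y ∷ r) (suc m) (suc s) ≡ ALG≥-from s (setOf (y ∷ u)) r y
  ALG≥-last s u y r refl =
    cong₂ (λ us ws → run A (setOf us) ws (suc s)) (take-length-++ u (y ∷ r)) (drop-length-++ u (y ∷ r))

  module _ (v : Subset n → ℚ) (m s : ℕ) where

    private
      ρ : List (Fin n) → List (Fin n)
      ρ = rotatePrefix (suc m)

      X : List (Fin n) → ℚ
      X o = v (ALG≥ A o (suc m) (suc s))

      H : List (Fin n) → List (Fin n) → Fin n → ℚ
      H us r j = v (ALG≥-from s (setOf us) r j)

    -- The t-th rotation of the prefix xs ++ ys makes the t-th element of xs arrive in round m + 1.
    orbitSum-ALG≥ : ∀ xs ys r → length (xs ++ ys) ≡ suc m →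
                    orbitSum ρ X (length xs) ((xs ++ ys) ++ r) ≡ sumℚ (map (H (xs ++ ys) r) xs)
    orbitSum-ALG≥ []       ys r _   = refl
    orbitSum-ALG≥ (x ∷ xs) ys r len = begin
      X (ρ o) + orbitSum ρ X (length xs) (ρ o)
        ≡⟨ cong (λ o′ → X o′ + orbitSum ρ X (length xs) o′) (rotatePrefix-++ (x ∷ xs ++ ys) r len) ⟩
      X (zs ++ r) + orbitSum ρ X (length xs) (zs ++ r)
        ≡⟨ cong₂ _+_ last-arrival later-arrivals ⟩
      H (x ∷ xs ++ ys) r x + sumℚ (map (H (x ∷ xs ++ ys) r) xs) ∎
      where
      open ≡-Reasoning
      o zs : List (Fin n)
      o = ((x ∷ xs) ++ ys) ++ r
      zs = (xs ++ ys) ++ x ∷ []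

      zs↭ : xs ++ ys ++ x ∷ [] ↭ x ∷ xs ++ ys
      zs↭ = ↭-trans (↭-reflexive (sym (++-assoc xs ys (x ∷ [])))) (rotate-↭ (x ∷ xs ++ ys))

      last-arrival : X (zs ++ r) ≡ H (x ∷ xs ++ ys) r x
      last-arrival = cong v (trans (cong (λ o′ → ALG≥ A o′ (suc m) (suc s)) (++-assoc (xs ++ ys) (x ∷ []) r))
                                   (ALG≥-last s (xs ++ ys) x r (ℕ.suc-injective len)))

      later-arrivals : orbitSum ρ X (length xs) (zs ++ r) ≡ sumℚ (map (H (x ∷ xs ++ ys) r) xs)
      later-arrivals = begin
        orbitSum ρ X (length xs) (zs ++ r)
          ≡⟨ cong (λ us → orbitSum ρ X (length xs) (us ++ r)) (++-assoc xs ys (x ∷ [])) ⟩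
        orbitSum ρ X (length xs) ((xs ++ ys ++ x ∷ []) ++ r)
          ≡⟨ orbitSum-ALG≥ xs (ys ++ x ∷ []) r (trans (↭-length zs↭) len) ⟩
        sumℚ (map (H (xs ++ ys ++ x ∷ []) r) xs)
          ≡⟨ cong (λ L → sumℚ (map (λ j → v (ALG≥-from s L r j)) xs)) (setOf-↭ zs↭) ⟩
        sumℚ (map (H (x ∷ xs ++ ys) r) xs) ∎

    orbitSum-ALG≥-prefix : ∀ o → suc m ℕ.≤ length o →
                           orbitSum ρ X (suc m) o ≡ sumℚ (map (H (take (suc m) o) (drop (suc m) o)) (take (suc m) o))
    orbitSum-ALG≥-prefix o ℓ≤ = begin
      orbitSum ρ X (suc m) o
        ≡⟨ cong₂ (orbitSum ρ X) (sym ∣q∣) (sym (trans (cong (_++ r) (++-identityʳ q)) (take++drop≡id (suc m) o))) ⟩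
      orbitSum ρ X (length q) ((q ++ []) ++ r)
        ≡⟨ orbitSum-ALG≥ q [] r (trans (cong length (++-identityʳ q)) ∣q∣) ⟩
      sumℚ (map (H (q ++ []) r) q)
        ≡⟨ cong (λ us → sumℚ (map (H us r) q)) (++-identityʳ q) ⟩
      sumℚ (map (H q r) q) ∎
      where
      open ≡-Reasoning
      q = take (suc m) o
      r = drop (suc m) o
      ∣q∣ = length-take-≤ (suc m) o ℓ≤

module _ {n k : ℕ} {v : Subset n → ℚ} (mono : Monotone v) (sub : Submodular v)
         {A : Subset n → Subset n} (A⊆ : ∀ L → A L ⊆ L) (A≤ : ∀ L → ∣ A L ∣ ℕ.≤ k)
         {m : ℕ} (m<n : m < n) (s : ℕ) where

  ALG≥-bound : ∀ {o} → o ∈ orders n →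
    v (A (prefixSet o (suc m))) + (ℕtoℚ k - 1ℚ) * v (ALG≥ A o (suc (suc m)) s)
      + (ℕtoℚ (suc m) - ℕtoℚ k) * v (ALG≥ A o (suc (suc m)) (suc s))
    ≤ orbitSum (rotatePrefix (suc m)) (λ o → v (ALG≥ A o (suc m) (suc s))) (suc m) o
  ALG≥-bound {o} o∈ = begin
    v a + (K - 1ℚ) * v B + (ℕtoℚ (suc m) - K) * v B′
      ≡⟨ cong (λ l → v a + (K - 1ℚ) * v B + (ℕtoℚ l - K) * v B′) ∣q∣ ⟨
    v a + (K - 1ℚ) * v B + (ℕtoℚ (length q) - K) * v B′
      ≤⟨ capacity-bound mono sub a B B′ q q! (A⊆ L) (A≤ L) (run-⊆-suc A L r s) ⟩
    sumℚ (map (λ j → v (ALG≥-from A s L r j)) q)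
      ≡⟨ orbitSum-ALG≥-prefix A v m s o ℓ≤ ⟨
    orbitSum (rotatePrefix (suc m)) (λ o → v (ALG≥ A o (suc m) (suc s))) (suc m) o ∎
    where
    open ≤-Reasoning
    ℓ≤ : suc m ℕ.≤ length o
    ℓ≤ = subst (suc m ℕ.≤_) (sym (length-∈-orders o∈)) m<n
    q r : List (Fin n)
    q = take (suc m) o
    r = drop (suc m) o
    ∣q∣ = length-take-≤ (suc m) o ℓ≤
    q! = Unique.take⁺ (suc m) (unique-∈-orders o∈)
    L a B B′ : Subset n
    L = setOf q
    a = A L
    B = run A L r s
    B′ = run A L r (suc s)
    K = ℕtoℚ k

lemma3 : (n k : ℕ) → 1 Data.Nat.≤ k
    → (v : Subset n → ℚ) → NonNegative v → Monotone v → Submodular v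
    → (A : Subset n → Subset n) → (∀ L → A L ⊆ L) → (∀ L → ∣ A L ∣ Data.Nat.≤ k)
    → (m : ℕ) → m < n → (s : ℕ) → s < k
    → (+ 1 / suc m) * ( E n (λ o → v (A (prefixSet o (suc m))))
                        + (ℕtoℚ k - 1ℚ) * E n (λ o → v (ALG≥ A o (suc (suc m)) s))
                        + (ℕtoℚ (suc m) - ℕtoℚ k) * E n (λ o → v (ALG≥ A o (suc (suc m)) (suc s))) )
      ≤ E n (λ o → v (ALG≥ A o (suc m) (suc s)))
lemma3 n k _ v _ mono sub A A⊆ A≤ m m<n s _ = begin
  ℓ⁻¹ * (E n f₁ + c₂ * E n f₂ + c₃ * E n f₃)      ≡⟨ cong (ℓ⁻¹ *_) linearity ⟨
  ℓ⁻¹ * E n (λ o → f₁ o + c₂ * f₂ o + c₃ * f₃ o)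
    ≤⟨ *-monoˡ-≤-nonNeg ℓ⁻¹ {{normalize-nonNeg 1 (suc m)}}
                        (mean-map-mono (orders n) (ALG≥-bound mono sub A⊆ A≤ m<n s)) ⟩
  ℓ⁻¹ * E n (orbitSum (rotatePrefix (suc m)) X (suc m))
    ≡⟨ cong (ℓ⁻¹ *_) (mean-orbitSum X (rotatePrefix-permutes-orders m<n) (suc m)) ⟩
  ℓ⁻¹ * (ℕtoℚ (suc m) * E n X)                      ≡⟨ *-assoc ℓ⁻¹ (ℕtoℚ (suc m)) (E n X) ⟨
  ℓ⁻¹ * ℕtoℚ (suc m) * E n X                        ≡⟨ cong (_* E n X) (1/suc-inverse m) ⟩
  1ℚ * E n X                                        ≡⟨ *-identityˡ (E n X) ⟩
  E n X                                             ∎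
  where
  open ≤-Reasoning
  ℓ⁻¹ = + 1 / suc m
  c₂ = ℕtoℚ k - 1ℚ
  c₃ = ℕtoℚ (suc m) - ℕtoℚ k
  f₁ f₂ f₃ X : List (Fin n) → ℚ
  f₁ o = v (A (prefixSet o (suc m)))
  f₂ o = v (ALG≥ A o (suc (suc m)) s)
  f₃ o = v (ALG≥ A o (suc (suc m)) (suc s))
  X o = v (ALG≥ A o (suc m) (suc s))
  linearity : E n (λ o → f₁ o + c₂ * f₂ o + c₃ * f₃ o) ≡ E n f₁ + c₂ * E n f₂ + c₃ * E n f₃
  linearity = trans (mean-map-+ (λ o → f₁ o + c₂ * f₂ o) (λ o → c₃ * f₃ o) (orders n))
    (cong₂ _+_ (trans (mean-map-+ f₁ (λ o → c₂ * f₂ o) (orders n)) (cong (_+_ (E n f₁)) (mean-map-* c₂ f₂ (orders n))))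
               (mean-map-* c₃ f₃ (orders n)))
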